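{- Let $\Gamma$ be a reduct theory and let $I$ be a well-supported model of $\Gamma$. Then $I\subseteq\bigcup_{i\ge0}T_\Gamma^i(\emptyset)$, i.e., $I$ is a subset of the least fixpoint of the immediate consequence operator of $\Gamma$.
   Context: Atoms are precomputed (ground) atoms $p(\mathbf r)$; a set $I$ of them is a propositional interpretation. A reduct theory is a (possibly infinite) set $\Gamma$ of propositional formulas each of the form $B_1\wedge\dots\wedge B_n\to(q(\mathbf r_1)\wedge\dots\wedge q(\mathbf r_m))$, where each $B_i=p_i(\mathbf r_{i,1})\vee\dots\vee p_i(\mathbf r_{i,m_i})$ (either conjunction may be empty, i.e. $\top$). For such $F$, $\mathrm{Head}(F)=\{q(\mathbf r_1),\dots,q(\mathbf r_m)\}$ and $\mathrm{Body}(F)=B_1\wedge\dots\wedge B_n$. A strict well-founded partial order on $I$ is an irreflexive transitive relation $\prec$ on $I$ with no infinite sequence $a_0,a_1,\dots$ with $a_{i+1}\prec a_i$ for all $i$. $I$ is a well-supported interpretation of $\Gamma$ iff there is a strict well-founded partial order $\prec$ on $I$ such that for every $p(\mathbf r)\in I$ there is $F\in\Gamma$ with (1) $p(\mathbf r)\in\mathrm{Head}(F)$, (2) $I\models\mathrm{Body}(F)$, (3) for every conjunct $p_i(\mathbf r_{i,1})\vee\dots\vee p_i(\mathbf r_{i,m_i})$ of $\mathrm{Body}(F)$ some $p_i(\mathbf r_{i,j})\in I$ satisfies $p_i(\mathbf r_{i,j})\prec p(\mathbf r)$. $I$ is a well-supported model of $\Gamma$ iff it is a well-supported interpretation of $\Gamma$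 and a model of $\Gamma$. Immediate consequence operator: $T_\Gamma(J)=\{p(\mathbf r): F\in\Gamma,\ p(\mathbf r)\in\mathrm{Head}(F),\ J\models\mathrm{Body}(F)\}$; $T_\Gamma^0(J)=J$, $T_\Gamma^{n+1}(J)=T_\Gamma^n(T_\Gamma(J))$. -}

module Defs where

open import Level using (0ℓ)
open import Data.Empty using (⊥)
open import Data.Nat using (ℕ; zero; suc)
open import Data.Product using (Σ; Σ-syntax; ∃; ∃-syntax; _×_; _,_)
open import Data.List using (List)
open import Data.List.Relation.Unary.All using (All)
open import Data.List.Relation.Unary.Any using (Any)
open import Data.List.Membership.Propositional using (_∈_)
open import Relation.Binary.PropositionalEquality using (_≡_)
open import Relation.Binary.Definitions using (Irreflexive; Transitive)
open import Relation.Nullary using (¬_)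
open import Induction.WellFounded using (WellFounded)

-- Ground atoms p(r): a predicate symbol together with a ground argument tuple.
module Reduct (Sym Args : Set) where

  Atom : Set
  Atom = Sym × Args

  Interp : Set₁
  Interp = Atom → Set

  -- A body conjunct  p(r₁) ∨ … ∨ p(rₖ)  (all disjuncts share the symbol p).
  Disj : Set
  Disj = Sym × List Args

  -- A reduct formula  B₁ ∧ … ∧ Bₙ → q(r₁) ∧ … ∧ q(rₘ).
  record Formula : Set where
    constructor _⇒_
    field
      body : List Disj          -- empty list = ⊤
      head : Sym × List Args    -- empty argument list = ⊤
  open Formula public

  Theory : Set₁
  Theory = Formula → Set

  _∈Head_ : Atom → Formula → Set
  (p , r) ∈Head F = let (q , rs) = head F in (p ≡ q) × (r ∈ rs)

  _⊨D_ : Interp → Disj → Set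
  I ⊨D (p , rs) = Any (λ r → I (p , r)) rs

  _⊨Body_ : Interp → Formula → Set
  I ⊨Body F = All (I ⊨D_) (body F)

  _⊨Head_ : Interp → Formula → Set
  I ⊨Head F = let (q , rs) = head F in All (λ r → I (q , r)) rs

  IsModel : Theory → Interp → Set
  IsModel Γ I = ∀ F → Γ F → I ⊨Body F → I ⊨Head F

  El : Interp → Set
  El I = Σ Atom I

  record StrictWFPO (I : Interp) : Set₁ where
    field
      _≺_     : El I → El I → Set
      irrefl  : ∀ x → ¬ (x ≺ x)
      trans   : Transitive _≺_
      wf      : WellFounded _≺_

  Supported : (I : Interp) → (El I → El I → Set) → El I → Formula → Set
  Supported I _≺_ x F =
    All (λ { (p , rs) → Any (λ r → Σ[ h ∈ I (p , r) ] ((p , r) , h) ≺ x) rs }) (body F)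

  IsWellSupportedInterp : Theory → Interp → Set₁
  IsWellSupportedInterp Γ I =
    Σ[ O ∈ StrictWFPO I ]
      (∀ (x : El I) → Σ[ F ∈ Formula ]
         (Γ F × (Σ.proj₁ x ∈Head F) × (I ⊨Body F) × Supported I (StrictWFPO._≺_ O) x F))

  IsWellSupportedModel : Theory → Interp → Set₁
  IsWellSupportedModel Γ I = IsWellSupportedInterp Γ I × IsModel Γ I

  T : Theory → Interp → Interp
  T Γ J a = Σ[ F ∈ Formula ] (Γ F × (a ∈Head F) × (J ⊨Body F))

  Tⁿ : Theory → ℕ → Interp → Interp
  Tⁿ Γ zero    J = J
  Tⁿ Γ (suc n) J = Tⁿ Γ n (T Γ J)

  ∅ : Interp
  ∅ _ = ⊥

  lfp : Theory → Interp
  lfp Γ a = ∃[ i ] Tⁿ Γ i ∅ a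

{-# OPTIONS --safe #-}
-- Well-founded induction along the support order: an atom of I heads a rule of Γ whose
-- body is satisfied by atoms strictly below it, hence by ⋃ Tⁱ(∅). The body is a finite
-- conjunction of finite disjunctions and the stages Tⁱ(∅) increase, so it is satisfied
-- already in one stage Tⁿ(∅), which puts the atom in Tⁿ⁺¹(∅).
module Submission where

open import Defs
open import Level using (Level)
open import Data.Nat using (ℕ; zero; suc; _≤_; _≤′_; ≤′-refl; ≤′-step; _⊔_)
open import Data.Nat.Properties using (≤⇒≤′; m≤m⊔n; m≤n⊔m)
open import Data.Product using (∃-syntax; _,_; proj₁)
open import Data.List.Relation.Unary.All as All using (All; []; _∷_)
open import Data.List.Relation.Unary.Any as Any using ()
open import Data.List.Relation.Unary.Any.Properties using (Any-Σ⁻ʳ)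
open import Relation.Unary using (Pred; _⊆_)
open import Induction.WellFounded using (Acc; acc)

module _ {a ℓ : Level} {A : Set a} {P : ℕ → Pred A ℓ} where

  ascending⇒monotone : (∀ n → P n ⊆ P (suc n)) → ∀ {m n} → m ≤ n → P m ⊆ P n
  ascending⇒monotone step m≤n = go (≤⇒≤′ m≤n)
    where
    go : ∀ {m n} → m ≤′ n → P m ⊆ P n
    go ≤′-refl        = λ x → x
    go (≤′-step m≤′n) = λ x → step _ (go m≤′n x)

  All-∃-bound : (∀ {m n} → m ≤ n → P m ⊆ P n) →
                ∀ {xs} → All (λ x → ∃[ n ] P n x) xs → ∃[ n ] All (P n) xs
  All-∃-bound mono []             = 0 , []
  All-∃-bound mono ((m , px) ∷ pxs) with All-∃-bound mono pxs
  ... | k , pxsₖ = m ⊔ k , mono (m≤m⊔n m k) px ∷ All.map (mono (m≤n⊔m m k)) pxsₖ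

module _ {Sym Args : Set} (Γ : Reduct.Theory Sym Args) where
  open Reduct Sym Args

  T-mono : ∀ {J K} → J ⊆ K → T Γ J ⊆ T Γ K
  T-mono J⊆K (F , F∈Γ , a∈head , J⊨body) = F , F∈Γ , a∈head , All.map (Any.map J⊆K) J⊨body

  Tⁿ-mono : ∀ n {J K} → J ⊆ K → Tⁿ Γ n J ⊆ Tⁿ Γ n K
  Tⁿ-mono zero    J⊆K = J⊆K
  Tⁿ-mono (suc n) J⊆K = Tⁿ-mono n (T-mono J⊆K)

  T-Tⁿ⊆Tⁿ⁺¹ : ∀ n J → T Γ (Tⁿ Γ n J) ⊆ Tⁿ Γ (suc n) J
  T-Tⁿ⊆Tⁿ⁺¹ zero    J = λ x → x
  T-Tⁿ⊆Tⁿ⁺¹ (suc n) J = T-Tⁿ⊆Tⁿ⁺¹ n (T Γ J)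

  Tⁿ∅-monotone : ∀ {m n} → m ≤ n → Tⁿ Γ m ∅ ⊆ Tⁿ Γ n ∅
  Tⁿ∅-monotone = ascending⇒monotone (λ n → Tⁿ-mono n (λ ()))

  T-lfp⊆lfp : T Γ (lfp Γ) ⊆ lfp Γ
  T-lfp⊆lfp (F , F∈Γ , a∈head , lfp⊨body)
    with All-∃-bound (λ m≤n → Any.map (Tⁿ∅-monotone m≤n)) (All.map Any-Σ⁻ʳ lfp⊨body)
  ... | n , Tⁿ⊨body = suc n , T-Tⁿ⊆Tⁿ⁺¹ n ∅ (F , F∈Γ , a∈head , Tⁿ⊨body)

  wellSupported⊆lfp : ∀ {I} → IsWellSupportedInterp Γ I → I ⊆ lfp Γ
  wellSupported⊆lfp {I} (O , support) {a} a∈I = go (a , a∈I) (wf (a , a∈I))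
    where
    open StrictWFPO O
    go : ∀ x → Acc _≺_ x → lfp Γ (proj₁ x)
    go x (acc below) with support x
    ... | F , F∈Γ , x∈head , _ , supported =
      T-lfp⊆lfp (F , F∈Γ , x∈head , All.map (Any.map below⊆lfp) supported)
      where
      below⊆lfp : ∀ {b} → (∃[ b∈I ] (b , b∈I) ≺ x) → lfp Γ b
      below⊆lfp (b∈I , b≺x) = go (_ , b∈I) (below b≺x)

mainTheorem6 : (Sym Args : Set) → (Γ : Reduct.Theory Sym Args) → (I : Reduct.Interp Sym Args)
    → Reduct.IsWellSupportedModel Sym Args Γ I
    → ∀ a → I a → Reduct.lfp Sym Args Γ a
mainTheorem6 Sym Args Γ I (wellSupported , _) a a∈I = wellSupported⊆lfp Γ wellSupported a∈I
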